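{- Let $c_1,\dots,c_s$ be a sequence of colours from $\{a_ib_k:i,k\in\mathbb{N}\}$, and let $\min_\Delta(c_1,\dots,c_s)$ be the coloured partition $\lambda_1+\dots+\lambda_s$ of minimal weight with $c(\lambda_i)=c_i$ for all $i$ satisfying $\lambda_i-\lambda_{i+1}\ge\Delta(c_i,c_{i+1})$ for $1\le i\le s-1$. Then $$|\min\nolimits_\Delta(c_1,\dots,c_s)|=\sum_{k=1}^s k\,\Delta(c_k,c_{k+1}),$$ with the convention $c_{s+1}=a_\infty b_\infty$ and $\Delta(c,a_\infty b_\infty)=1$ for every colour $c$.
   Context: With $\chi(P)\in\{0,1\}$ the truth value of $P$, $\Delta(a_ib_k,a_{i'}b_{k'})=\chi(i\ge i')-\chi(i=k=i')+\chi(k\le k')-\chi(k=i'=k')$. Parts of partitions are positive integers; the weight is the sum of the parts. -}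

module Defs where

open import Data.Nat using (ℕ; zero; suc; _+_; _*_; _∸_; _≤_; _<_; _≥?_; _≤?_; _<?_; _≟_)
open import Data.Bool using (Bool; true; false; _∧_)
open import Data.Fin using (Fin; toℕ; fromℕ<)
import Data.Fin as F
open import Data.Product using (_×_; _,_)
open import Relation.Nullary.Decidable using (⌊_⌋; yes; no)
open import Relation.Binary.PropositionalEquality using (_≡_)

-- The colour a_i b_k is represented by the pair (i , k).
Colour : Set
Colour = ℕ × ℕ

data ExtColour : Set where
  fin : Colour → ExtColour
  ∞   : ExtColour

χ : Bool → ℕ
χ true  = 1
χ false = 0

-- Each difference is nonnegative (i = k = i' implies i ≥ i'; k = i' = k' implies k ≤ k'),
-- so truncated subtraction on ℕ computes it exactly.
Δ : Colour → Colour → ℕ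
Δ (i , k) (i' , k') =
    (χ ⌊ i ≥? i' ⌋ ∸ χ (⌊ i ≟ k ⌋ ∧ ⌊ k ≟ i' ⌋))
  + (χ ⌊ k ≤? k' ⌋ ∸ χ (⌊ k ≟ i' ⌋ ∧ ⌊ i' ≟ k' ⌋))

Δ∞ : Colour → ExtColour → ℕ
Δ∞ c (fin c') = Δ c c'
Δ∞ c ∞        = 1

-- The n-th colour (0-based) of the sequence c_1..c_s, and a_∞ b_∞ beyond it.
extend : ∀ {s} → (Fin s → Colour) → ℕ → ExtColour
extend {s} c n with n <? s
... | yes p = fin (c (fromℕ< p))
... | no _  = ∞

∑ : (n : ℕ) → (Fin n → ℕ) → ℕ
∑ zero    f = 0
∑ (suc n) f = f F.zero + ∑ n (λ i → f (F.suc i))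

weight : ∀ {s} → (Fin s → ℕ) → ℕ
weight {s} l = ∑ s l

Admissible : ∀ {s} → (Fin s → Colour) → (Fin s → ℕ) → Set
Admissible {s} c l =
  ((i : Fin s) → 1 ≤ l i) ×
  ((i j : Fin s) → suc (toℕ i) ≡ toℕ j → l j + Δ (c i) (c j) ≤ l i)

formula : ∀ {s} → (Fin s → Colour) → ℕ
formula {s} c = ∑ s (λ k → suc (toℕ k) * Δ∞ (c k) (extend c (suc (toℕ k))))

-- Put λ_i = Δ(c_i,c_{i+1}) + ... + Δ(c_s,c_{s+1}), where Δ(c_s,c_{s+1}) = 1. This partition
-- meets every difference condition with equality and has last part 1, so by descending induction
-- on i every admissible partition dominates it part by part. Its weight counts Δ(c_k,c_{k+1})
-- once in each of λ_1, ..., λ_k.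
module Submission where

open import Defs
open import Data.Nat using (ℕ; zero; suc; _+_; _*_; _≤_; z≤n; s≤s; _<?_)
open import Data.Nat.Properties
  using (≤-trans; ≤-reflexive; ≤-pred; +-mono-≤; +-monoʳ-≤; m≤n+m;
         +-comm; +-assoc; +-identityʳ; suc-injective; +-commutativeSemigroup;
         module ≤-Reasoning)
open import Algebra.Properties.CommutativeSemigroup +-commutativeSemigroup using (interchange)
open import Data.Fin using (Fin; toℕ)
import Data.Fin as F
open import Data.Fin.Properties using (fromℕ<-cong)
open import Data.Product using (Σ; _×_; _,_)
open import Data.Empty using (⊥-elim)
open import Function using (_∘_)
open import Relation.Nullary using (yes; no)
open import Relation.Binary.PropositionalEquality using (_≡_; refl; sym; trans; cong; cong₂; module ≡-Reasoning)

∑-cong : ∀ n {f g : Fin n → ℕ} → (∀ i → f i ≡ g i) → ∑ n f ≡ ∑ n g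
∑-cong zero    f≗g = refl
∑-cong (suc n) f≗g = cong₂ _+_ (f≗g F.zero) (∑-cong n (f≗g ∘ F.suc))

∑-mono : ∀ n {f g : Fin n → ℕ} → (∀ i → f i ≤ g i) → ∑ n f ≤ ∑ n g
∑-mono zero    f≤g = z≤n
∑-mono (suc n) f≤g = +-mono-≤ (f≤g F.zero) (∑-mono n (f≤g ∘ F.suc))

∑-distrib-+ : ∀ n (f g : Fin n → ℕ) → ∑ n (λ i → f i + g i) ≡ ∑ n f + ∑ n g
∑-distrib-+ zero    f g = refl
∑-distrib-+ (suc n) f g =
  trans (cong (f F.zero + g F.zero +_) (∑-distrib-+ n (f ∘ F.suc) (g ∘ F.suc)))
        (interchange (f F.zero) (g F.zero) _ _)

∑-weighted-suc : ∀ n (f : Fin (suc n) → ℕ) →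
  ∑ (suc n) (λ k → suc (toℕ k) * f k) ≡ ∑ (suc n) f + ∑ n (λ k → suc (toℕ k) * f (F.suc k))
∑-weighted-suc n f = begin
  f F.zero + 0 + ∑ n (λ k → f (F.suc k) + suc (toℕ k) * f (F.suc k))
    ≡⟨ cong₂ _+_ (+-identityʳ (f F.zero)) (∑-distrib-+ n (f ∘ F.suc) _) ⟩
  f F.zero + (∑ n (f ∘ F.suc) + ∑ n (λ k → suc (toℕ k) * f (F.suc k)))
    ≡⟨ sym (+-assoc (f F.zero) _ _) ⟩
  ∑ (suc n) f + ∑ n (λ k → suc (toℕ k) * f (F.suc k)) ∎
  where open ≡-Reasoning

extend-zero : ∀ {n} (c : Fin (suc n) → Colour) → extend c 0 ≡ fin (c F.zero)
extend-zero {n} c with 0 <? suc n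
... | yes _  = refl
... | no 0≮s = ⊥-elim (0≮s (s≤s z≤n))

extend-empty : (c : Fin 0 → Colour) (m : ℕ) → extend c m ≡ ∞
extend-empty c m with m <? 0
... | no _ = refl

extend-suc : ∀ {n} (c : Fin (suc n) → Colour) m → extend c (suc m) ≡ extend (c ∘ F.suc) m
extend-suc {n} c m with suc m <? suc n | m <? n
... | yes p | yes q = cong (fin ∘ c ∘ F.suc) (fromℕ<-cong m m refl (≤-pred p) q)
... | yes p | no q  = ⊥-elim (q (≤-pred p))
... | no p  | yes q = ⊥-elim (p (s≤s q))
... | no p  | no q  = refl

-- The least possible value of λ_k − λ_{k+1}, with λ_{s+1} read as 0.
gap : ∀ {s} → (Fin s → Colour) → Fin s → ℕ
gap c k = Δ∞ (c k) (extend c (suc (toℕ k)))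

gap-suc : ∀ {n} (c : Fin (suc n) → Colour) k → gap c (F.suc k) ≡ gap (c ∘ F.suc) k
gap-suc c k = cong (Δ∞ (c (F.suc k))) (extend-suc c (suc (toℕ k)))

gap-last : (c : Fin 1 → Colour) → gap c F.zero ≡ 1
gap-last c = cong (Δ∞ (c F.zero)) (trans (extend-suc c 0) (extend-empty (c ∘ F.suc) 0))

gap-zero : ∀ {n} (c : Fin (suc (suc n)) → Colour) → gap c F.zero ≡ Δ (c F.zero) (c (F.suc F.zero))
gap-zero c = cong (Δ∞ (c F.zero)) (trans (extend-suc c 0) (extend-zero (c ∘ F.suc)))

minΔ : ∀ {s} → (Fin s → Colour) → Fin s → ℕ
minΔ {suc n} c F.zero    = ∑ (suc n) (gap c)
minΔ {suc n} c (F.suc i) = minΔ (c ∘ F.suc) i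

minΔ-zero : ∀ {n} (c : Fin (suc (suc n)) → Colour) →
  minΔ c F.zero ≡ Δ (c F.zero) (c (F.suc F.zero)) + minΔ (c ∘ F.suc) F.zero
minΔ-zero {n} c = cong₂ _+_ (gap-zero c) (∑-cong (suc n) (gap-suc c))

minΔ-positive : ∀ {s} (c : Fin s → Colour) i → 1 ≤ minΔ c i
minΔ-positive {1}           c F.zero    = ≤-reflexive (sym (cong (_+ 0) (gap-last c)))
minΔ-positive {suc (suc n)} c F.zero    =
  ≤-trans (minΔ-positive (c ∘ F.suc) F.zero)
          (≤-trans (m≤n+m _ (Δ (c F.zero) (c (F.suc F.zero)))) (≤-reflexive (sym (minΔ-zero c))))
minΔ-positive {suc (suc n)} c (F.suc i) = minΔ-positive (c ∘ F.suc) i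

minΔ-step : ∀ {s} (c : Fin s → Colour) (i j : Fin s) → suc (toℕ i) ≡ toℕ j →
  minΔ c j + Δ (c i) (c j) ≤ minΔ c i
minΔ-step {suc (suc n)} c F.zero (F.suc F.zero) refl =
  ≤-reflexive (trans (+-comm (minΔ (c ∘ F.suc) F.zero) _) (sym (minΔ-zero c)))
minΔ-step {suc (suc n)} c (F.suc i) (F.suc j) i+1≡j =
  minΔ-step (c ∘ F.suc) i j (suc-injective i+1≡j)

minΔ-admissible : ∀ {s} (c : Fin s → Colour) → Admissible c (minΔ c)
minΔ-admissible c = minΔ-positive c , minΔ-step c

admissible-suc : ∀ {n} (c : Fin (suc n) → Colour) l →
  Admissible c l → Admissible (c ∘ F.suc) (l ∘ F.suc)
admissible-suc c l (l≥1 , l-step) = l≥1 ∘ F.suc , λ i j i+1≡j → l-step (F.suc i) (F.suc j) (cong suc i+1≡j)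

minΔ-least : ∀ {s} (c : Fin s → Colour) l → Admissible c l → ∀ i → minΔ c i ≤ l i
minΔ-least {1}           c l (l≥1 , _) F.zero = ≤-trans (≤-reflexive (cong (_+ 0) (gap-last c))) (l≥1 F.zero)
minΔ-least {suc (suc n)} c l adm@(_ , l-step) F.zero = begin
  minΔ c F.zero                                          ≡⟨ minΔ-zero c ⟩
  Δ (c F.zero) (c (F.suc F.zero)) + minΔ (c ∘ F.suc) F.zero
    ≤⟨ +-monoʳ-≤ (Δ (c F.zero) (c (F.suc F.zero))) (minΔ-least (c ∘ F.suc) (l ∘ F.suc) (admissible-suc c l adm) F.zero) ⟩
  Δ (c F.zero) (c (F.suc F.zero)) + l (F.suc F.zero)    ≡⟨ +-comm _ (l (F.suc F.zero)) ⟩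
  l (F.suc F.zero) + Δ (c F.zero) (c (F.suc F.zero))    ≤⟨ l-step F.zero (F.suc F.zero) refl ⟩
  l F.zero                                               ∎
  where open ≤-Reasoning
minΔ-least {suc (suc n)} c l adm (F.suc i) = minΔ-least (c ∘ F.suc) (l ∘ F.suc) (admissible-suc c l adm) i

weight-minΔ : ∀ {s} (c : Fin s → Colour) → weight (minΔ c) ≡ formula c
weight-minΔ {zero}  c = refl
weight-minΔ {suc n} c = begin
  ∑ (suc n) (gap c) + weight (minΔ (c ∘ F.suc))   ≡⟨ cong (∑ (suc n) (gap c) +_) (weight-minΔ (c ∘ F.suc)) ⟩
  ∑ (suc n) (gap c) + formula (c ∘ F.suc)
    ≡⟨ cong (∑ (suc n) (gap c) +_) (∑-cong n (λ k → cong (suc (toℕ k) *_) (gap-suc c k))) ⟨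
  ∑ (suc n) (gap c) + ∑ n (λ k → suc (toℕ k) * gap c (F.suc k))   ≡⟨ ∑-weighted-suc n (gap c) ⟨
  formula c                                        ∎
  where open ≡-Reasoning

proposition2p2 : (s : ℕ) (c : Fin s → Colour) →
    Σ (Fin s → ℕ) (λ l → Admissible c l × weight l ≡ formula c ×
      ((l' : Fin s → ℕ) → Admissible c l' → weight l ≤ weight l'))
proposition2p2 s c =
  minΔ c , minΔ-admissible c , weight-minΔ c ,
  λ l adm → ∑-mono s (minΔ-least c l adm)
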